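{- Let $(M,\mathcal{C},\mathcal{C}^*)$ be a Farkas property oriented matroid. Then both $\mathcal{C}$ and $\mathcal{C}^*$ have the strong circuit elimination property (CE).
   Context: Matroids are in the sense of Bruhn, Diestel, Kriesell, Pendavingh and Wollan (possibly infinite ground set) on $E$; cocircuits are circuits of the dual. A signed subset $X$ of $E$ is a support $\underline{X}\subseteq E$ with a partition $(X^+,X^-)$; $-X$ swaps the parts; $X|_A$ has parts $X^\pm\cap A$; $X$ is positive if $\underline{X}=X^+\neq\emptyset$; $\mathrm{sep}(X,Y)=(X^+\cap Y^-)\cup(X^-\cap Y^+)$. The reorientation ${}_{ -A}X$ has ${}_{ -A}X^+=(X^+\setminus A)\cup(X^-\cap A)$, ${}_{ -A}X^-=(X^-\setminus A)\cup(X^+\cap A)$; ${}_{ -A}\mathcal{S}=\{{}_{ -A}X:X\in\mathcal{S}\}$. A circuit signature of $M$ is a set of signed subsets consisting of exactly two opposite signed subsets supported by each circuit; a cocircuit signature is a circuit signature of $M^*$. A pair $\mathcal{S},\mathcal{T}$ of sets of signed subsets of $E'$ has the Farkas property if for every $e\in E'$ exactly one holds: some positive $X\in\mathcal{S}$ has $e\in\underline{X}$, or some positive $Y\in\mathcal{T}$ has $e\in\underline{Y}$. For a minor $N=M/F\setminus G$ with ground set $E(N)$: $\mathcal{S}^{\mathcal{C}}(N)=\{C|_{E(N)}: C\in\mathcal{C},\ \underline{C|_{E(N)}}\text{ a circuit of }N,\ \underline{C}\subseteq E(N)\cup F\}$, $\mathcal{S}^{\mathcal{C}^*}(N)=\{U|_{E(N)}:U\in\mathcal{C}^*,\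 \underline{U|_{E(N)}}\text{ a cocircuit of }N,\ \underline{U}\subseteq E(N)\cup G\}$. $(M,\mathcal{C},\mathcal{C}^*)$ is Farkas property oriented if for every minor $N$ and every $A\subseteq E(N)$ the pair ${}_{ -A}\mathcal{S}^{\mathcal{C}}(N),{}_{ -A}\mathcal{S}^{\mathcal{C}^*}(N)$ has the Farkas property. A set $\mathcal{D}$ of signed subsets has property (CE) if: whenever $C\in\mathcal{D}$, $X\subseteq\underline{C}$ and $(C_x\mid x\in X)$ is a family in $\mathcal{D}$ with $\underline{C_x}\cap X=\{x\}$ and $x\in\mathrm{sep}(C,C_x)$ for all $x\in X$, then for every $f\in\underline{C}\setminus\bigcup_{x\in X}\mathrm{sep}(C,C_x)$ there is $D\in\mathcal{D}$ with $f\in\underline{D}$, $D^+\subseteq(C^+\cup\bigcup_xC_x^+)\setminus X$ and $D^-\subseteq(C^-\cup\bigcup_xC_x^-)\setminus X$. -}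

module Defs where

open import Data.Product using (Σ; ∃; _×_; _,_; proj₁; proj₂)
open import Data.Sum using (_⊎_; inj₁; inj₂)
open import Data.Empty using (⊥)
open import Relation.Nullary using (¬_)
open import Relation.Binary.PropositionalEquality using (_≡_)
open import Relation.Unary using (Pred; _∈_; _∉_; _⊆_; _≐_; _∪_; _∩_; _∖_; ∅)

Subset : Set → Set₁
Subset E = Pred E _

module _ {E : Set} where

  ⟦_⟧ : E → Subset E
  ⟦ x ⟧ = λ y → y ≡ x

  Disjoint : Subset E → Subset E → Set
  Disjoint X Y = ∀ e → e ∈ X → e ∈ Y → ⊥

record IndepSys (E : Set) : Set₂ where
  field
    ground : Subset E
    Indep  : Subset E → Set₁

open IndepSys public

module _ {E : Set} (M : IndepSys E) where

  Base : Subset E → Set₁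
  Base B = Indep M B × (∀ J → Indep M J → B ⊆ J → J ⊆ B)

  Dependent : Subset E → Set₁
  Dependent D = D ⊆ ground M × ¬ Indep M D

  Circuit : Subset E → Set₁
  Circuit C = Dependent C × (∀ D → Dependent D → D ⊆ C → C ⊆ D)

  -- matroid axioms (Bruhn–Diestel–Kriesell–Pendavingh–Wollan):
  -- (I1), (I2), (I3), (IM), plus: independent sets lie in the ground set
  -- and independence is a property of sets (extensional).
  record IsMatroid : Set₁ where
    field
      indep-ext    : ∀ I J → I ≐ J → Indep M I → Indep M J
      indep-ground : ∀ I → Indep M I → I ⊆ ground M
      I1 : Indep M ∅
      I2 : ∀ I J → Indep M J → I ⊆ J → Indep M I
      I3 : ∀ I I′ → Indep M I → ¬ Base I → Base I′ →
           Σ E λ x → x ∈ I′ × x ∉ I × Indep M (I ∪ ⟦ x ⟧)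
      IM : ∀ I (X : Subset E) → Indep M I → I ⊆ X → X ⊆ ground M →
           Σ (Subset E) λ J → Indep M J × I ⊆ J × J ⊆ X ×
             (∀ K → Indep M K → J ⊆ K → K ⊆ X → K ⊆ J)

module _ {E : Set} where

  -- dual: bases of M* are the complements (in the ground set) of bases of M;
  -- independent sets of M* are the subsets of bases of M*.
  dual : IndepSys E → IndepSys E
  dual M = record
    { ground = ground M
    ; Indep  = λ I → I ⊆ ground M × Σ (Subset E) λ B → Base M B × Disjoint I B }

  delete : IndepSys E → Subset E → IndepSys E
  delete M G = record
    { ground = ground M ∖ G
    ; Indep  = λ I → Indep M I × I ⊆ (ground M ∖ G) }

  contract : IndepSys E → Subset E → IndepSys E
  contract M F = dual (delete (dual M) F)

  minor : IndepSys E → Subset E → Subset E → IndepSys E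
  minor M F G = delete (contract M F) G

  Cocircuit : IndepSys E → Subset E → Set₁
  Cocircuit M = Circuit (dual M)

record Signed (E : Set) : Set₁ where
  field
    pos  : Subset E
    neg  : Subset E
    disj : Disjoint pos neg

open Signed public

SignedSet : Set → Set₂
SignedSet E = Signed E → Set₁

module _ {E : Set} where

  support : Signed E → Subset E
  support X = pos X ∪ neg X

  _≈ˢ_ : Signed E → Signed E → Set
  X ≈ˢ Y = (pos X ≐ pos Y) × (neg X ≐ neg Y)

  opp : Signed E → Signed E
  opp X = record { pos = neg X ; neg = pos X ; disj = λ e p q → disj X e q p }

  restrict : Signed E → Subset E → Signed E
  restrict X A = record
    { pos = pos X ∩ A ; neg = neg X ∩ A
    ; disj = λ e p q → disj X e (proj₁ p) (proj₁ q) }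

  Positive : Signed E → Set
  Positive X = (∀ e → e ∉ neg X) × Σ E λ e → e ∈ pos X

  sep : Signed E → Signed E → Subset E
  sep X Y = (pos X ∩ neg Y) ∪ (neg X ∩ pos Y)

  reorient : Subset E → Signed E → Signed E
  reorient A X = record
    { pos  = (pos X ∖ A) ∪ (neg X ∩ A)
    ; neg  = (neg X ∖ A) ∪ (pos X ∩ A)
    ; disj = d }
    where
    d : Disjoint ((pos X ∖ A) ∪ (neg X ∩ A)) ((neg X ∖ A) ∪ (pos X ∩ A))
    d e (inj₁ (p , _)) (inj₁ (q , _)) = disj X e p q
    d e (inj₁ (_ , nA)) (inj₂ (_ , a)) = nA a
    d e (inj₂ (_ , a)) (inj₁ (_ , nA)) = nA a
    d e (inj₂ (q , _)) (inj₂ (p , _)) = disj X e p q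

  reorientSet : Subset E → SignedSet E → SignedSet E
  reorientSet A 𝒮 Y = Σ (Signed E) λ X → 𝒮 X × (Y ≈ˢ reorient A X)

  CircuitSignature : IndepSys E → SignedSet E → Set₁
  CircuitSignature M 𝒞 =
    (∀ X → 𝒞 X → Circuit M (support X)) ×
    (∀ C → Circuit M C →
       Σ (Signed E) λ X → 𝒞 X × (support X ≐ C) ×
         (Σ (Signed E) λ Y → 𝒞 Y × (Y ≈ˢ opp X)) ×
         (∀ Y → 𝒞 Y → support Y ≐ C → (Y ≈ˢ X) ⊎ (Y ≈ˢ opp X)))

  CocircuitSignature : IndepSys E → SignedSet E → Set₁
  CocircuitSignature M = CircuitSignature (dual M)

  HasPosThrough : SignedSet E → E → Set₁
  HasPosThrough 𝒮 e = Σ (Signed E) λ X → 𝒮 X × Positive X × e ∈ support X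

  Farkas : Subset E → SignedSet E → SignedSet E → Set₁
  Farkas E′ 𝒮 𝒯 = ∀ e → e ∈ E′ →
    (HasPosThrough 𝒮 e × ¬ HasPosThrough 𝒯 e) ⊎
    (¬ HasPosThrough 𝒮 e × HasPosThrough 𝒯 e)

  SC : IndepSys E → SignedSet E → Subset E → Subset E → SignedSet E
  SC M 𝒞 F G Y = Σ (Signed E) λ C → 𝒞 C ×
    (Y ≈ˢ restrict C (ground N)) ×
    Circuit N (support (restrict C (ground N))) ×
    (support C ⊆ (ground N ∪ F))
    where N = minor M F G

  SC* : IndepSys E → SignedSet E → Subset E → Subset E → SignedSet E
  SC* M 𝒞* F G Y = Σ (Signed E) λ U → 𝒞* U ×
    (Y ≈ˢ restrict U (ground N)) ×
    Cocircuit N (support (restrict U (ground N))) ×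
    (support U ⊆ (ground N ∪ G))
    where N = minor M F G

  FarkasOriented : IndepSys E → SignedSet E → SignedSet E → Set₁
  FarkasOriented M 𝒞 𝒞* =
    ∀ F G → F ⊆ ground M → G ⊆ ground M → Disjoint F G →
    ∀ A → A ⊆ ground (minor M F G) →
    Farkas (ground (minor M F G))
           (reorientSet A (SC M 𝒞 F G))
           (reorientSet A (SC* M 𝒞* F G))

  CE : SignedSet E → Set₁
  CE 𝒟 =
    ∀ C → 𝒟 C → ∀ (X : Subset E) → X ⊆ support C →
    ∀ (Cx : ∀ x → x ∈ X → Signed E) →
    (∀ x (x∈X : x ∈ X) → 𝒟 (Cx x x∈X)) →
    (∀ x (x∈X : x ∈ X) → (support (Cx x x∈X) ∩ X) ≐ ⟦ x ⟧) →
    (∀ x (x∈X : x ∈ X) → x ∈ sep C (Cx x x∈X)) →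
    ∀ f → f ∈ support C →
    (∀ x (x∈X : x ∈ X) → f ∉ sep C (Cx x x∈X)) →
    Σ (Signed E) λ D → 𝒟 D × f ∈ support D ×
      (pos D ⊆ ((pos C ∪ (λ e → Σ E λ x → Σ (x ∈ X) λ x∈X → e ∈ pos (Cx x x∈X))) ∖ X)) ×
      (neg D ⊆ ((neg C ∪ (λ e → Σ E λ x → Σ (x ∈ X) λ x∈X → e ∈ neg (Cx x x∈X))) ∖ X))

-- The Farkas property first gives orthogonality: if a signed circuit C and a
-- signed cocircuit U meet and agree in sign on C ∩ U, then in M / (C ∖ U), after
-- reorienting the negative part of U, both C and U restrict to positive signed
-- sets through a common element, which the Farkas property forbids.
-- For (CE), contract the elements admissible with both signs, delete X and the
-- elements off C ∪ ⋃ Cx, reorient so that every remaining element has its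
-- admissible sign positive, and apply the Farkas property at f: a positive
-- circuit through f is the eliminant, while a positive cocircuit through f would
-- be conformal to C, or else to the Cx at an element x ∈ X where it disagrees
-- with C, contradicting orthogonality. Cocircuits are handled dually, with
-- contraction and deletion exchanged.

module Submission where

open import Defs
open import Data.Product using (Σ; _×_; _,_; proj₁; proj₂)
open import Data.Sum using (_⊎_; inj₁; inj₂; [_,_]′)
open import Data.Empty using (⊥-elim)
open import Level using (Lift; lift; lower)
open import Relation.Nullary using (Dec; yes; no; ¬_)
open import Relation.Nullary.Decidable using (map′; decidable-stable)
open import Relation.Binary.PropositionalEquality using (refl; sym; subst)
open import Relation.Unary using (_∈_; _∉_; _⊆_; _≐_; _∪_; _∩_; _∖_; ∁; ∅)

module _ {E : Set} where

  _-_ : Subset E → E → Subset E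
  C - c = C ∖ ⟦ c ⟧

  record _≃_ (N N′ : IndepSys E) : Set₁ where
    field
      ground⊆ : ground N ⊆ ground N′
      ground⊇ : ground N′ ⊆ ground N
      indep⇒  : ∀ {I} → Indep N I → Indep N′ I
      indep⇐  : ∀ {I} → Indep N′ I → Indep N I

  ≃-sym : ∀ {N N′} → N ≃ N′ → N′ ≃ N
  ≃-sym N≃N′ = record { ground⊆ = ground⊇ ; ground⊇ = ground⊆ ; indep⇒ = indep⇐ ; indep⇐ = indep⇒ }
    where open _≃_ N≃N′

  base-≃ : ∀ {N N′ B} → N ≃ N′ → Base N B → Base N′ B
  base-≃ N≃N′ (iB , maxB) = indep⇒ iB , λ J iJ → maxB J (indep⇐ iJ)
    where open _≃_ N≃N′

  circuit-≃ : ∀ {N N′ C} → N ≃ N′ → Circuit N C → Circuit N′ C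
  circuit-≃ N≃N′ ((C⊆g , ¬iC) , minC) =
    ((λ c → ground⊆ (C⊆g c)) , λ iC → ¬iC (indep⇐ iC)) ,
    λ D (D⊆g , ¬iD) → minC D ((λ d → ground⊇ (D⊆g d)) , λ iD → ¬iD (indep⇒ iD))
    where open _≃_ N≃N′

  dual-≃ : ∀ {N N′} → N ≃ N′ → dual N ≃ dual N′
  dual-≃ N≃N′ = record
    { ground⊆ = ground⊆
    ; ground⊇ = ground⊇
    ; indep⇒  = λ (I⊆g , B , bB , I#B) → (λ i → ground⊆ (I⊆g i)) , B , base-≃ N≃N′ bB , I#B
    ; indep⇐  = λ (I⊆g , B , bB , I#B) → (λ i → ground⊇ (I⊆g i)) , B , base-≃ (≃-sym N≃N′) bB , I#B
    }
    where open _≃_ N≃N′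

  delete-∅-≃ : ∀ {N} → (∀ {I} → Indep N I → I ⊆ ground N) → N ≃ delete N ∅
  delete-∅-≃ indep⊆ground = record
    { ground⊆ = λ x → x , λ ()
    ; ground⊇ = proj₁
    ; indep⇒  = λ iI → iI , λ i → indep⊆ground iI i , λ ()
    ; indep⇐  = proj₁
    }

  dual-indep-≐ : ∀ {N} {I J : Subset E} → I ≐ J → Indep (dual N) I → Indep (dual N) J
  dual-indep-≐ (_ , J⊆I) (I⊆g , B , bB , I#B) = (λ j → I⊆g (J⊆I j)) , B , bB , λ e j → I#B e (J⊆I j)

  circuit-≐ : ∀ {N} {C C′ : Subset E} → (∀ {I J : Subset E} → I ≐ J → Indep N I → Indep N J) →
              C ≐ C′ → Circuit N C → Circuit N C′
  circuit-≐ indep-≐ (C⊆C′ , C′⊆C) ((C⊆g , ¬iC) , minC) =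
    ((λ c → C⊆g (C′⊆C c)) , λ iC′ → ¬iC (indep-≐ (C′⊆C , C⊆C′) iC′)) ,
    λ D depD D⊆C′ c′ → minC D depD (λ d → C′⊆C (D⊆C′ d)) (C′⊆C c′)

  ≈ˢ-refl : ∀ {X : Signed E} → X ≈ˢ X
  ≈ˢ-refl = ((λ p → p) , (λ p → p)) , ((λ p → p) , (λ p → p))

  support-≈ˢ : ∀ {X Y : Signed E} → X ≈ˢ Y → support X ⊆ support Y
  support-≈ˢ ((X⁺⊆Y⁺ , _) , _) (inj₁ p) = inj₁ (X⁺⊆Y⁺ p)
  support-≈ˢ (_ , (X⁻⊆Y⁻ , _)) (inj₂ q) = inj₂ (X⁻⊆Y⁻ q)

  support-restrict : ∀ {X : Signed E} {R : Subset E} → support (restrict X R) ≐ (support X ∩ R)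
  support-restrict =
    (λ { (inj₁ (p , r)) → inj₁ p , r ; (inj₂ (q , r)) → inj₂ q , r }) ,
    (λ { (inj₁ p , r) → inj₁ (p , r) ; (inj₂ q , r) → inj₂ (q , r) })

  support-reorient⁻ : ∀ {A : Subset E} {Y : Signed E} → support (reorient A Y) ⊆ support Y
  support-reorient⁻ (inj₁ (inj₁ (p , _))) = inj₁ p
  support-reorient⁻ (inj₁ (inj₂ (q , _))) = inj₂ q
  support-reorient⁻ (inj₂ (inj₁ (q , _))) = inj₂ q
  support-reorient⁻ (inj₂ (inj₂ (p , _))) = inj₁ p

  sep⊆support₂ : ∀ {P Q : Signed E} → sep P Q ⊆ support Q
  sep⊆support₂ (inj₁ (_ , q)) = inj₂ q
  sep⊆support₂ (inj₂ (_ , p)) = inj₁ p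

  Agree : Signed E → Signed E → E → Set
  Agree P W e = (e ∈ pos P × e ∈ pos W) ⊎ (e ∈ neg P × e ∈ neg W)

  Conformal : Signed E → Signed E → Set
  Conformal P W = ∀ e → e ∈ support P → e ∈ support W → Agree P W e

  -- Half of the orthogonality of signed circuits and cocircuits.
  NeverConformal : SignedSet E → SignedSet E → Set₁
  NeverConformal 𝒟 𝒪 = ∀ P W → 𝒟 P → 𝒪 W → ∀ e → e ∈ support P → e ∈ support W → ¬ Conformal P W

  never-conformal-sym : ∀ {𝒟 𝒪} → NeverConformal 𝒟 𝒪 → NeverConformal 𝒪 𝒟
  never-conformal-sym never W P W∈𝒪 P∈𝒟 e e∈W e∈P W≍P =
    never P W P∈𝒟 W∈𝒪 e e∈P e∈W λ e′ e′∈P e′∈W → flip (W≍P e′ e′∈W e′∈P)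
    where
    flip : ∀ {e′} → Agree W P e′ → Agree P W e′
    flip (inj₁ (a , b)) = inj₁ (b , a)
    flip (inj₂ (a , b)) = inj₂ (b , a)

  sep-flip : ∀ {P Q W : Signed E} {e} → e ∈ sep P Q → e ∈ support W → ¬ Agree P W e → Agree Q W e
  sep-flip (inj₁ (pP , _))  (inj₁ pW) ¬agree = ⊥-elim (¬agree (inj₁ (pP , pW)))
  sep-flip (inj₁ (_ , nQ))  (inj₂ nW) _      = inj₂ (nQ , nW)
  sep-flip (inj₂ (_ , pQ))  (inj₁ pW) _      = inj₁ (pQ , pW)
  sep-flip (inj₂ (nP , _))  (inj₂ nW) ¬agree = ⊥-elim (¬agree (inj₂ (nP , nW)))

  -- X restricted to EN becomes nonnegative once A is reoriented.
  NonnegOn : Subset E → Subset E → Signed E → Set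
  NonnegOn EN A X = (∀ e → e ∈ EN → e ∈ pos X → e ∉ A) × (∀ e → e ∈ EN → e ∈ neg X → e ∈ A)

  WitnessThrough : SignedSet E → Subset E → Subset E → Subset E → E → Set₁
  WitnessThrough 𝒟 R EN A f =
    Σ (Signed E) λ X → 𝒟 X × support X ⊆ R × f ∈ support X × NonnegOn EN A X

module Classical (dec : (P : Set₁) → Dec P) where

  decide : (P : Set) → Dec P
  decide P = map′ lower lift (dec (Lift _ P))

  ¬¬-elim : {P : Set} → ¬ ¬ P → P
  ¬¬-elim = decidable-stable (decide _)

  ¬¬-elim₁ : {P : Set₁} → ¬ ¬ P → P
  ¬¬-elim₁ = decidable-stable (dec _)

  module _ {E : Set} where

    ⊊circuit⇒indep : ∀ {N C D} {c : E} → Circuit N C → D ⊆ C → c ∈ C → c ∉ D → Indep N D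
    ⊊circuit⇒indep ((C⊆g , _) , minC) D⊆C c∈C c∉D =
      ¬¬-elim₁ λ ¬iD → c∉D (minC _ ((λ d → C⊆g (D⊆C d)) , ¬iD) D⊆C c∈C)

    circuit-minus⇒indep : ∀ {N C} {c : E} → Circuit N C → c ∈ C → Indep N (C - c)
    circuit-minus⇒indep circC c∈C = ⊊circuit⇒indep circC proj₁ c∈C λ c∈C-c → proj₂ c∈C-c refl

    support-reorient⁺ : ∀ {A : Subset E} {Y : Signed E} → support Y ⊆ support (reorient A Y)
    support-reorient⁺ {A} {x = e} e∈Y with decide (e ∈ A) | e∈Y
    ... | yes a | inj₁ p = inj₂ (inj₂ (p , a))
    ... | yes a | inj₂ q = inj₁ (inj₂ (q , a))
    ... | no ¬a | inj₁ p = inj₁ (inj₁ (p , ¬a))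
    ... | no ¬a | inj₂ q = inj₂ (inj₁ (q , ¬a))

    conformal-or-disagree : ∀ (P W : Signed E) →
      Conformal P W ⊎ Σ E λ e → e ∈ support P × e ∈ support W × ¬ Agree P W e
    conformal-or-disagree P W with decide (Σ E λ e → e ∈ support P × e ∈ support W × ¬ Agree P W e)
    ... | yes disagreement = inj₂ disagreement
    ... | no ¬disagreement = inj₁ λ e p w → ¬¬-elim λ ¬agree → ¬disagreement (e , p , w , ¬agree)

    positive-through : ∀ {𝒮 : SignedSet E} {A : Subset E} {Y e} →
      𝒮 Y → (∀ x → x ∉ neg (reorient A Y)) → e ∈ support Y → HasPosThrough (reorientSet A 𝒮) e
    positive-through {A = A} {Y} {e} Y∈𝒮 nonneg e∈Y =
      reorient A Y , (Y , Y∈𝒮 , ≈ˢ-refl {X = reorient A Y}) , (nonneg , e , e∈pos) , inj₁ e∈pos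
      where
      e∈pos : e ∈ pos (reorient A Y)
      e∈pos with support-reorient⁺ {A} {Y} e∈Y
      ... | inj₁ p = p
      ... | inj₂ q = ⊥-elim (nonneg e q)

    witness-through : ∀ {𝒟 : SignedSet E} {Q : Signed E → Set₁} {EN A R : Subset E} {f} →
      HasPosThrough (reorientSet A λ Y → Σ (Signed E) λ X →
                       𝒟 X × (Y ≈ˢ restrict X EN) × Q X × support X ⊆ R) f →
      WitnessThrough 𝒟 R EN A f
    witness-through {EN = EN} {A} {f = f}
      (Y , (Y₀ , (X , X∈𝒟 , Y₀≈X|EN , _ , X⊆R) , Y≈Y₀′) , (Y-nonneg , _) , f∈Y) =
      X , X∈𝒟 , X⊆R , f∈X , pos-off-A , neg-in-A
      where
      Y₀′-nonneg : ∀ x → x ∉ neg (reorient A Y₀)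
      Y₀′-nonneg x n = Y-nonneg x (proj₂ (proj₂ Y≈Y₀′) n)
      f∈Y₀ : f ∈ support Y₀
      f∈Y₀ = support-reorient⁻ {A = A} {Y = Y₀} (support-≈ˢ {X = Y} {Y = reorient A Y₀} Y≈Y₀′ f∈Y)
      f∈X : f ∈ support X
      f∈X = proj₁ (proj₁ (support-restrict {X = X} {R = EN})
                          (support-≈ˢ {X = Y₀} {Y = restrict X EN} Y₀≈X|EN f∈Y₀))
      pos-off-A : ∀ e → e ∈ EN → e ∈ pos X → e ∉ A
      pos-off-A e e∈EN p a = Y₀′-nonneg e (inj₂ (proj₂ (proj₁ Y₀≈X|EN) (p , e∈EN) , a))
      neg-in-A : ∀ e → e ∈ EN → e ∈ neg X → e ∈ A
      neg-in-A e e∈EN q = ¬¬-elim λ ¬a → Y₀′-nonneg e (inj₁ (proj₂ (proj₂ Y₀≈X|EN) (q , e∈EN) , ¬a))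

    -- Mixed elements (admissible with both signs) are contracted for circuits and
    -- deleted for cocircuits, Outside elements the other way round.
    module Elimination {𝒟 𝒪 : SignedSet E} {g : Subset E}
      (𝒟⊆g : ∀ X → 𝒟 X → support X ⊆ g) (never : NeverConformal 𝒟 𝒪)
      (C : Signed E) (C∈𝒟 : 𝒟 C) (X : Subset E)
      (Cx : ∀ x → x ∈ X → Signed E) (Cx∈𝒟 : ∀ x (x∈X : x ∈ X) → 𝒟 (Cx x x∈X))
      (Cx∩X : ∀ x (x∈X : x ∈ X) → (support (Cx x x∈X) ∩ X) ≐ ⟦ x ⟧)
      (x∈sep : ∀ x (x∈X : x ∈ X) → x ∈ sep C (Cx x x∈X))
      (f : E) (f∈C : f ∈ support C) (f∉sep : ∀ x (x∈X : x ∈ X) → f ∉ sep C (Cx x x∈X)) where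

      Pos Neg : Subset E
      Pos = pos C ∪ (λ e → Σ E λ x → Σ (x ∈ X) λ x∈X → e ∈ pos (Cx x x∈X))
      Neg = neg C ∪ (λ e → Σ E λ x → Σ (x ∈ X) λ x∈X → e ∈ neg (Cx x x∈X))

      Mixed Outside : Subset E
      Mixed = (Pos ∩ Neg) ∖ X
      Outside = g ∩ (X ∪ ∁ (Pos ∪ Neg))

      Eliminant : Set₁
      Eliminant = Σ (Signed E) λ D → 𝒟 D × f ∈ support D × pos D ⊆ (Pos ∖ X) × neg D ⊆ (Neg ∖ X)

      Pos⊆g : Pos ⊆ g
      Pos⊆g (inj₁ p) = 𝒟⊆g C C∈𝒟 (inj₁ p)
      Pos⊆g (inj₂ (x , x∈X , p)) = 𝒟⊆g (Cx x x∈X) (Cx∈𝒟 x x∈X) (inj₁ p)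

      Mixed⊆g : Mixed ⊆ g
      Mixed⊆g ((p , _) , _) = Pos⊆g p

      Mixed#Outside : Disjoint Mixed Outside
      Mixed#Outside e (_ , e∉X) (_ , inj₁ e∈X) = e∉X e∈X
      Mixed#Outside e ((p , _) , _) (_ , inj₂ e∉Pos∪Neg) = e∉Pos∪Neg (inj₁ p)

      Outside#Mixed : Disjoint Outside Mixed
      Outside#Mixed e o m = Mixed#Outside e m o

      f∉X : f ∉ X
      f∉X f∈X = f∉sep f f∈X (x∈sep f f∈X)

      f-remains : f ∈ ((g ∖ Outside) ∖ Mixed)
      f-remains = (𝒟⊆g C C∈𝒟 f∈C , f∉Outside) , f∉Mixed f∈C
        where
        f∉Outside : f ∉ Outside
        f∉Outside (_ , inj₁ f∈X) = f∉X f∈X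
        f∉Outside (_ , inj₂ f∉Pos∪Neg) =
          f∉Pos∪Neg ([ (λ p → inj₁ (inj₁ p)) , (λ q → inj₂ (inj₁ q)) ]′ f∈C)
        f∉Mixed : f ∈ support C → f ∉ Mixed
        f∉Mixed (inj₁ p) ((_ , inj₁ q) , _) = disj C f p q
        f∉Mixed (inj₁ p) ((_ , inj₂ (x , x∈X , q)) , _) = f∉sep x x∈X (inj₁ (p , q))
        f∉Mixed (inj₂ q) ((inj₁ p , _) , _) = disj C f p q
        f∉Mixed (inj₂ q) ((inj₂ (x , x∈X , p) , _) , _) = f∉sep x x∈X (inj₂ (q , p))

      module _ {EN : Subset E} (EN-remains : EN ⊆ ((g ∖ Outside) ∖ Mixed)) where

        A : Subset E
        A = EN ∩ Neg

        EN⊆Pos∪Neg : EN ⊆ (Pos ∪ Neg)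
        EN⊆Pos∪Neg e∈EN = ¬¬-elim λ e∉Pos∪Neg →
          proj₂ (proj₁ (EN-remains e∈EN)) (proj₁ (proj₁ (EN-remains e∈EN)) , inj₂ e∉Pos∪Neg)

        EN#X : ∀ {e} → e ∈ EN → e ∉ X
        EN#X e∈EN e∈X = proj₂ (proj₁ (EN-remains e∈EN)) (proj₁ (proj₁ (EN-remains e∈EN)) , inj₁ e∈X)

        eliminant : WitnessThrough 𝒟 (EN ∪ Mixed) EN A f → Eliminant
        eliminant (D , D∈𝒟 , D⊆EN∪Mixed , f∈D , pos-off-A , neg-in-A) = D , D∈𝒟 , f∈D , D⁺-ok , D⁻-ok
          where
          D⁺-ok : pos D ⊆ (Pos ∖ X)
          D⁺-ok {e} p with D⊆EN∪Mixed (inj₁ p)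
          ... | inj₂ ((p′ , _) , e∉X) = p′ , e∉X
          ... | inj₁ e∈EN with EN⊆Pos∪Neg e∈EN
          ...   | inj₁ p′ = p′ , EN#X e∈EN
          ...   | inj₂ q′ = ⊥-elim (pos-off-A e e∈EN p (e∈EN , q′))
          D⁻-ok : neg D ⊆ (Neg ∖ X)
          D⁻-ok {e} q with D⊆EN∪Mixed (inj₂ q)
          ... | inj₂ ((_ , q′) , e∉X) = q′ , e∉X
          ... | inj₁ e∈EN = proj₂ (neg-in-A e e∈EN q) , EN#X e∈EN

        agree-off-X : ∀ {P W} → pos P ⊆ Pos → neg P ⊆ Neg →
                      support W ⊆ (EN ∪ Outside) → NonnegOn EN A W → ∀ {e} → e ∈ support P → e ∈ support W → e ∉ X → Agree P W e
        agree-off-X P⁺⊆Pos P⁻⊆Neg W⊆EN∪Outside (W⁺-off-A , W⁻-in-A) {e} e∈P e∈W e∉X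
          with W⊆EN∪Outside e∈W
        ... | inj₂ (_ , inj₁ e∈X) = ⊥-elim (e∉X e∈X)
        ... | inj₂ (_ , inj₂ e∉Pos∪Neg) =
          ⊥-elim (e∉Pos∪Neg ([ (λ p → inj₁ (P⁺⊆Pos p)) , (λ q → inj₂ (P⁻⊆Neg q)) ]′ e∈P))
        ... | inj₁ e∈EN with e∈P | e∈W
        ...   | inj₁ p | inj₁ pW = inj₁ (p , pW)
        ...   | inj₁ p | inj₂ qW =
          ⊥-elim (proj₂ (EN-remains e∈EN) ((P⁺⊆Pos p , proj₂ (W⁻-in-A e e∈EN qW)) , e∉X))
        ...   | inj₂ q | inj₁ pW = ⊥-elim (W⁺-off-A e e∈EN pW (e∈EN , P⁻⊆Neg q))
        ...   | inj₂ q | inj₂ qW = inj₂ (q , qW)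

        no-cowitness : ¬ WitnessThrough 𝒪 (EN ∪ Outside) EN A f
        no-cowitness (W , W∈𝒪 , W⊆EN∪Outside , f∈W , W-nonneg) with conformal-or-disagree C W
        ... | inj₁ C≍W = never C W C∈𝒟 W∈𝒪 f f∈C f∈W C≍W
        ... | inj₂ (x , x∈C , x∈W , ¬agree) with decide (x ∈ X)
        ...   | no x∉X = ¬agree (agree-off-X {P = C} {W = W} inj₁ inj₁ W⊆EN∪Outside W-nonneg x∈C x∈W x∉X)
        ...   | yes x∈X =
          never (Cx x x∈X) W (Cx∈𝒟 x x∈X) W∈𝒪 x x∈Cx x∈W Cx≍W
          where
          x∈Cx : x ∈ support (Cx x x∈X)
          x∈Cx = sep⊆support₂ {P = C} {Q = Cx x x∈X} (x∈sep x x∈X)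
          Cx≍W : Conformal (Cx x x∈X) W
          Cx≍W e e∈Cx e∈W with decide (e ∈ X)
          ... | no e∉X = agree-off-X {P = Cx x x∈X} {W = W}
                           (λ p → inj₂ (x , x∈X , p)) (λ q → inj₂ (x , x∈X , q))
                           W⊆EN∪Outside W-nonneg e∈Cx e∈W e∉X
          ... | yes e∈X = subst (Agree (Cx x x∈X) W) (sym (proj₁ (Cx∩X x x∈X) (e∈Cx , e∈X)))
                                (sep-flip {P = C} {Q = Cx x x∈X} {W = W} (x∈sep x x∈X) x∈W ¬agree)

  module Matroid {E : Set} (M : IndepSys E) (isM : IsMatroid M) where
    open IsMatroid isM

    private
      g : Subset E
      g = ground M

    TraceMaximal : Subset E → Subset E → Set₁
    TraceMaximal F J = ∀ K → Indep M K → (J ∩ F) ⊆ K → K ⊆ F → K ⊆ J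

    ⊆⇒TraceMaximal : ∀ {F J : Subset E} → F ⊆ J → TraceMaximal F J
    ⊆⇒TraceMaximal F⊆J _ _ _ K⊆F k = F⊆J (K⊆F k)

    maximal⇒base : ∀ {X B J : Subset E} → Base M B → B ⊆ X → Indep M J → J ⊆ X →
                   (∀ K → Indep M K → J ⊆ K → K ⊆ X → K ⊆ J) → Base M J
    maximal⇒base {X} {B} {J} bB B⊆X iJ J⊆X maxJ with dec (Base M J)
    ... | yes bJ = bJ
    ... | no ¬bJ with I3 J B iJ ¬bJ bB
    ...   | x , x∈B , x∉J , iJ+x = ⊥-elim (x∉J (maxJ (J ∪ ⟦ x ⟧) iJ+x inj₁ J+x⊆X (inj₂ refl)))
      where
      J+x⊆X : (J ∪ ⟦ x ⟧) ⊆ X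
      J+x⊆X (inj₁ j) = J⊆X j
      J+x⊆X (inj₂ refl) = B⊆X x∈B

    extend-to-base : ∀ {I : Subset E} → Indep M I → Σ (Subset E) λ J → Base M J × I ⊆ J
    extend-to-base {I} iI with IM I g iI (indep-ground I iI) (λ x → x)
    ... | J , iJ , I⊆J , _ , maxJ = J , (iJ , λ K iK J⊆K → maxJ K iK J⊆K (indep-ground K iK)) , I⊆J

    extend-to-base-within : ∀ {I X B : Subset E} → Base M B → B ⊆ X → X ⊆ g → Indep M I → I ⊆ X →
                            Σ (Subset E) λ J → Base M J × I ⊆ J × J ⊆ X
    extend-to-base-within {I} {X} bB B⊆X X⊆g iI I⊆X with IM I X iI I⊆X X⊆g
    ... | J , iJ , I⊆J , J⊆X , maxJ = J , maximal⇒base bB B⊆X iJ J⊆X maxJ , I⊆J , J⊆X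

    base-with-maximal-trace : ∀ {F X B : Subset E} → Base M B → B ⊆ X → X ⊆ g → F ⊆ X →
                              Σ (Subset E) λ J → Base M J × J ⊆ X × TraceMaximal F J
    base-with-maximal-trace {F} bB B⊆X X⊆g F⊆X
      with IM ∅ F I1 (λ ()) (λ f → X⊆g (F⊆X f))
    ... | IF , iIF , _ , IF⊆F , maxIF with extend-to-base-within bB B⊆X X⊆g iIF (λ i → F⊆X (IF⊆F i))
    ...   | J , bJ , IF⊆J , J⊆X = J , bJ , J⊆X , trace
      where
      trace : TraceMaximal F J
      trace K iK J∩F⊆K K⊆F k = IF⊆J (maxIF K iK (λ i → J∩F⊆K (IF⊆J i , IF⊆F i)) K⊆F k)

    cobase-delete : ∀ {F J : Subset E} → Base M J → TraceMaximal F J →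
                    Base (delete (dual M) F) ((g ∖ F) ∖ J)
    cobase-delete {F} {J} bJ@(iJ , maxJ) trace =
      (((λ e → proj₁ (proj₁ e)) , J , bJ , λ e e∉J e∈J → proj₂ e∉J e∈J) , proj₁) , maximal
      where
      maximal : ∀ K → Indep (delete (dual M) F) K → ((g ∖ F) ∖ J) ⊆ K → K ⊆ ((g ∖ F) ∖ J)
      maximal K ((_ , B , bB , K#B) , K⊆g∖F) cob⊆K {e} e∈K = K⊆g∖F e∈K , e∉J
        where
        -- Exchanging e out of J for an element x of B: x cannot be in F by
        -- maximality of the trace, nor outside F since then x ∈ K.
        e∉J : e ∉ J
        e∉J e∈J with I3 (J - e) B (I2 _ J iJ proj₁) (λ (_ , max) → proj₂ (max J iJ proj₁ e∈J) refl) bB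
        ... | x , x∈B , x∉J-e , iJ-e+x with decide (x ∈ F)
        ...   | no x∉F = K#B x (cob⊆K ((indep-ground B (proj₁ bB) x∈B , x∉F) , x∉J)) x∈B
          where
          x∉J : x ∉ J
          x∉J x∈J = x∉J-e (x∈J , λ { refl → K#B e e∈K x∈B })
        ...   | yes x∈F =
          x∉J-e (trace K′ (I2 K′ _ iJ-e+x K′⊆J-e+x) inj₁ K′⊆F (inj₂ refl) , λ { refl → K#B e e∈K x∈B })
          where
          K′ : Subset E
          K′ = (J ∩ F) ∪ ⟦ x ⟧
          K′⊆J-e+x : K′ ⊆ ((J - e) ∪ ⟦ x ⟧)
          K′⊆J-e+x (inj₁ (j , f)) = inj₁ (j , λ { refl → proj₂ (K⊆g∖F e∈K) f })
          K′⊆J-e+x (inj₂ refl) = inj₂ refl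
          K′⊆F : K′ ⊆ F
          K′⊆F (inj₁ (_ , f)) = f
          K′⊆F (inj₂ refl) = x∈F

    contract-indep : ∀ {F J D : Subset E} → Base M J → TraceMaximal F J → D ⊆ (g ∖ F) → D ⊆ J →
                     Indep (contract M F) D
    contract-indep bJ trace D⊆g∖F D⊆J =
      D⊆g∖F , _ , cobase-delete bJ trace , λ e d c → proj₂ c (D⊆J d)

    contract-base : ∀ {F J : Subset E} → Base M J → TraceMaximal F J → Base (contract M F) (J ∖ F)
    contract-base {F} {J} bJ trace =
      contract-indep bJ trace (λ (j , f) → indep-ground J (proj₁ bJ) j , f) proj₁ , maximal
      where
      maximal : ∀ K → Indep (contract M F) K → (J ∖ F) ⊆ K → K ⊆ (J ∖ F)
      maximal K (K⊆g∖F , B , (iB , maxB) , K#B) J∖F⊆K {e} e∈K with decide (e ∈ J)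
      ... | yes e∈J = e∈J , proj₂ (K⊆g∖F e∈K)
      ... | no e∉J = ⊥-elim (K#B e e∈K (maxB _ (proj₁ (cobase-delete bJ trace)) B⊆cob (K⊆g∖F e∈K , e∉J)))
        where
        B⊆cob : B ⊆ ((g ∖ F) ∖ J)
        B⊆cob b = proj₂ iB b , λ j → K#B _ (J∖F⊆K (j , proj₂ (proj₂ iB b))) b

    contract-indep⇒∪-indep : ∀ {F S : Subset E} → Indep M F → Indep (contract M F) S → Indep M (S ∪ F)
    contract-indep⇒∪-indep {F} {S} iF (S⊆g∖F , B′ , (((B′⊆g , B , bB , B′#B) , B′⊆g∖F) , maxB′) , S#B′)
      with extend-to-base-within {X = g ∖ B′} bB B⊆g∖B′ proj₁ iF F⊆g∖B′
      where
      B⊆g∖B′ : B ⊆ (g ∖ B′)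
      B⊆g∖B′ b = indep-ground B (proj₁ bB) b , λ b′ → B′#B _ b′ b
      F⊆g∖B′ : F ⊆ (g ∖ B′)
      F⊆g∖B′ f = indep-ground F iF f , λ b′ → proj₂ (B′⊆g∖F b′) f
    ... | J , bJ , F⊆J , J⊆g∖B′ = I2 (S ∪ F) J (proj₁ bJ) λ { (inj₁ s) → S⊆J s ; (inj₂ f) → F⊆J f }
      where
      -- An element of S outside J could be added to the cobase B′.
      S⊆J : S ⊆ J
      S⊆J {s} s∈S = ¬¬-elim λ s∉J → S#B′ s s∈S (maxB′ (B′ ∪ ⟦ s ⟧) (iB′+s s∉J) inj₁ (inj₂ refl))
        where
        iB′+s : s ∉ J → Indep (delete (dual M) F) (B′ ∪ ⟦ s ⟧)
        iB′+s s∉J =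
          ( (λ { (inj₁ b′) → B′⊆g b′ ; (inj₂ refl) → proj₁ (S⊆g∖F s∈S) })
          , J , bJ , λ { e (inj₁ b′) j → proj₂ (J⊆g∖B′ j) b′ ; e (inj₂ refl) j → s∉J j })
          , λ { (inj₁ b′) → B′⊆g∖F b′ ; (inj₂ refl) → S⊆g∖F s∈S }

    contract-circuit : ∀ {C F : Subset E} {e₀} → Circuit M C → F ⊆ C → e₀ ∈ (C ∖ F) →
                       Circuit (contract M F) (C ∖ F)
    contract-circuit {C} {F} circC@((C⊆g , ¬iC) , _) F⊆C (e₀∈C , e₀∉F) =
      ((λ (c , c∉F) → C⊆g c , c∉F) , dependent) , minimal
      where
      dependent : ¬ Indep (contract M F) (C ∖ F)
      dependent iC∖F = ¬iC (I2 C _ (contract-indep⇒∪-indep iF iC∖F) C⊆C∖F∪F)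
        where
        iF : Indep M F
        iF = ⊊circuit⇒indep circC F⊆C e₀∈C e₀∉F
        C⊆C∖F∪F : C ⊆ ((C ∖ F) ∪ F)
        C⊆C∖F∪F {c} c∈C with decide (c ∈ F)
        ... | yes c∈F = inj₂ c∈F
        ... | no c∉F = inj₁ (c∈C , c∉F)
      minimal : ∀ D → Dependent (contract M F) D → D ⊆ (C ∖ F) → (C ∖ F) ⊆ D
      minimal D (D⊆g∖F , ¬iD) D⊆C∖F {s} (s∈C , s∉F) = ¬¬-elim λ s∉D → ¬iD (independent s∉D)
        where
        independent : s ∉ D → Indep (contract M F) D
        independent s∉D with extend-to-base (circuit-minus⇒indep circC s∈C)
        ... | J , bJ , C-s⊆J = contract-indep bJ (⊆⇒TraceMaximal F⊆J) D⊆g∖F D⊆J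
          where
          F⊆J : F ⊆ J
          F⊆J f = C-s⊆J (F⊆C f , λ { refl → s∉F f })
          D⊆J : D ⊆ J
          D⊆J d = C-s⊆J (proj₁ (D⊆C∖F d) , λ { refl → s∉D d })

    contract-cocircuit : ∀ {U F : Subset E} → Circuit (dual M) U → F ⊆ g → Disjoint F U →
                         Circuit (dual (contract M F)) U
    contract-cocircuit {U} {F} circU@((U⊆g , ¬iU) , _) F⊆g F#U =
      ((λ u → U⊆g u , λ f → F#U _ f u) , dependent) , minimal
      where
      -- A base B of M avoiding the cobase B′ behind a base BN of M / F also avoids U,
      -- since any u ∈ U ∩ B could be added to BN.
      dependent : ¬ Indep (dual (contract M F)) U
      dependent (_ , BN ,
                 (iBN@(BN⊆g∖F , B′ , bB′@(((_ , B , bB , B′#B) , _) , _) , BN#B′) , maxBN) , U#BN) =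
        ¬iU (U⊆g , B , bB , U#B)
        where
        U#B : Disjoint U B
        U#B u u∈U u∈B = U#BN u u∈U (maxBN (BN ∪ ⟦ u ⟧) iBN+u inj₁ (inj₂ refl))
          where
          iBN+u : Indep (contract M F) (BN ∪ ⟦ u ⟧)
          iBN+u = (λ { (inj₁ b) → BN⊆g∖F b ; (inj₂ refl) → U⊆g u∈U , λ f → F#U u f u∈U })
                , B′ , bB′ , λ { e (inj₁ b) b′ → BN#B′ e b b′ ; e (inj₂ refl) b′ → B′#B e b′ u∈B }
      -- For s ∈ U ∖ D, a base J of M inside g ∖ (U - s) with maximal trace on F
      -- yields the base J ∖ F of M / F, which avoids D.
      minimal : ∀ D → Dependent (dual (contract M F)) D → D ⊆ U → U ⊆ D
      minimal D (D⊆g∖F , ¬iD) D⊆U {s} s∈U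
        with circuit-minus⇒indep circU s∈U
      ... | _ , Bs , bBs , U-s#Bs
        with base-with-maximal-trace {F} {g ∖ (U - s)} bBs
               (λ b → indep-ground Bs (proj₁ bBs) b , λ u → U-s#Bs _ u b) proj₁
               (λ f → F⊆g f , λ u → F#U _ f (proj₁ u))
      ... | J , bJ , J⊆g∖U-s , trace =
        ¬¬-elim λ s∉D → ¬iD (D⊆g∖F , J ∖ F , contract-base bJ trace ,
                             λ e d (j , _) → proj₂ (J⊆g∖U-s j) (D⊆U d , λ { refl → s∉D d }))

    module ConformalMeeting {𝒞 𝒞* : SignedSet E}
      (𝒞-circuits : ∀ X → 𝒞 X → Circuit M (support X))
      (𝒞*-cocircuits : ∀ X → 𝒞* X → Circuit (dual M) (support X))
      (C U : Signed E) (C∈𝒞 : 𝒞 C) (U∈𝒞* : 𝒞* U) (C≍U : Conformal C U) where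

      F : Subset E
      F = support C ∖ support U

      N : IndepSys E
      N = minor M F ∅

      A : Subset E
      A = ground N ∩ neg U

      C⊆g : support C ⊆ g
      C⊆g = proj₁ (proj₁ (𝒞-circuits C C∈𝒞))

      U⊆N : support U ⊆ ground N
      U⊆N u = (proj₁ (proj₁ (𝒞*-cocircuits U U∈𝒞*)) u , λ (_ , u∉U) → u∉U u) , λ ()

      contract≃N : contract M F ≃ N
      contract≃N = delete-∅-≃ proj₁

      C|N U|N : Signed E
      C|N = restrict C (ground N)
      U|N = restrict U (ground N)

      support-C|N : support C|N ≐ (support C ∩ ground N)
      support-C|N = support-restrict {X = C} {R = ground N}

      support-U|N : support U|N ≐ (support U ∩ ground N)
      support-U|N = support-restrict {X = U} {R = ground N}

      circuit-side : ∀ {e₀} → e₀ ∈ support C → e₀ ∈ support U →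
                     HasPosThrough (reorientSet A (SC M 𝒞 F ∅)) e₀
      circuit-side {e₀} e₀∈C e₀∈U =
        positive-through {𝒮 = SC M 𝒞 F ∅} {Y = C|N}
          (C , C∈𝒞 , ≈ˢ-refl {X = C|N} , C|N-circuit , C⊆N∪F)
          nonneg (proj₂ support-C|N (e₀∈C , U⊆N e₀∈U))
        where
        C∖F≐C|N : (support C ∖ F) ≐ support C|N
        C∖F≐C|N = (λ (c , c∉F) → proj₂ support-C|N (c , (C⊆g c , c∉F) , λ ()))
                , (λ r → let c , n = proj₁ support-C|N r in c , proj₂ (proj₁ n))
        C|N-circuit : Circuit N (support C|N)
        C|N-circuit = circuit-≃ contract≃N (circuit-≐ dual-indep-≐ C∖F≐C|N
          (contract-circuit (𝒞-circuits C C∈𝒞) proj₁ (e₀∈C , λ (_ , e₀∉U) → e₀∉U e₀∈U)))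
        C⊆N∪F : support C ⊆ (ground N ∪ F)
        C⊆N∪F {c} c∈C with decide (c ∈ support U)
        ... | yes c∈U = inj₁ (U⊆N c∈U)
        ... | no c∉U = inj₂ (c∈C , c∉U)
        nonneg : ∀ x → x ∉ neg (reorient A C|N)
        nonneg x (inj₁ ((q , n) , x∉A))
          with C≍U x (inj₂ q) (¬¬-elim λ x∉U → proj₂ (proj₁ n) (inj₂ q , x∉U))
        ... | inj₁ (p , _) = disj C x p q
        ... | inj₂ (_ , qU) = x∉A (n , qU)
        nonneg x (inj₂ ((p , _) , (_ , qU))) with C≍U x (inj₁ p) (inj₂ qU)
        ... | inj₁ (_ , pU) = disj U x pU qU
        ... | inj₂ (q , _) = disj C x p q

      cocircuit-side : ∀ {e₀} → e₀ ∈ support U → HasPosThrough (reorientSet A (SC* M 𝒞* F ∅)) e₀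
      cocircuit-side {e₀} e₀∈U =
        positive-through {𝒮 = SC* M 𝒞* F ∅} {Y = U|N}
          (U , U∈𝒞* , ≈ˢ-refl {X = U|N} , U|N-cocircuit , λ u → inj₁ (U⊆N u))
          nonneg (proj₂ support-U|N (e₀∈U , U⊆N e₀∈U))
        where
        U≐U|N : support U ≐ support U|N
        U≐U|N = (λ u → proj₂ support-U|N (u , U⊆N u)) , (λ r → proj₁ (proj₁ support-U|N r))
        U|N-cocircuit : Cocircuit N (support U|N)
        U|N-cocircuit = circuit-≃ (dual-≃ contract≃N) (circuit-≐ dual-indep-≐ U≐U|N
          (contract-cocircuit (𝒞*-cocircuits U U∈𝒞*) (λ (c , _) → C⊆g c) λ e (_ , e∉U) e∈U → e∉U e∈U))
        nonneg : ∀ x → x ∉ neg (reorient A U|N)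
        nonneg x (inj₁ ((q , n) , x∉A)) = x∉A (n , q)
        nonneg x (inj₂ ((p , _) , (_ , q))) = disj U x p q

    farkas⇒never-conformal : ∀ {𝒞 𝒞* : SignedSet E} →
      (∀ X → 𝒞 X → Circuit M (support X)) → (∀ X → 𝒞* X → Circuit (dual M) (support X)) →
      FarkasOriented M 𝒞 𝒞* → NeverConformal 𝒞 𝒞*
    farkas⇒never-conformal 𝒞-circuits 𝒞*-cocircuits far C U C∈𝒞 U∈𝒞* e₀ e₀∈C e₀∈U C≍U =
      [ (λ (_ , ¬U-positive) → ¬U-positive (cocircuit-side e₀∈U))
      , (λ (¬C-positive , _) → ¬C-positive (circuit-side e₀∈C e₀∈U)) ]′
        (far F ∅ (λ (c , _) → C⊆g c) (λ ()) (λ _ _ ()) A proj₁ e₀ (U⊆N e₀∈U))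
      where open ConformalMeeting 𝒞-circuits 𝒞*-cocircuits C U C∈𝒞 U∈𝒞* C≍U

    circuit-elimination : ∀ {𝒞 𝒞* : SignedSet E} → (∀ X → 𝒞 X → Circuit M (support X)) →
      NeverConformal 𝒞 𝒞* → FarkasOriented M 𝒞 𝒞* → CE 𝒞
    circuit-elimination 𝒞-circuits never far C C∈𝒞 X _ Cx Cx∈𝒞 Cx∩X x∈sep f f∈C f∉sep =
      [ (λ (circuit-side , _) → eliminant EN-remains (witness-through circuit-side))
      , (λ (_ , cocircuit-side) → ⊥-elim (no-cowitness EN-remains (witness-through cocircuit-side))) ]′
        (far Mixed Outside Mixed⊆g proj₁ Mixed#Outside (A EN-remains) proj₁ f f∈EN)
      where
      open Elimination (λ Y Y∈𝒞 → proj₁ (proj₁ (𝒞-circuits Y Y∈𝒞))) never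
                       C C∈𝒞 X Cx Cx∈𝒞 Cx∩X x∈sep f f∈C f∉sep
      EN-remains : ((g ∖ Mixed) ∖ Outside) ⊆ ((g ∖ Outside) ∖ Mixed)
      EN-remains ((e∈g , e∉Mixed) , e∉Outside) = (e∈g , e∉Outside) , e∉Mixed
      f∈EN : f ∈ ((g ∖ Mixed) ∖ Outside)
      f∈EN = let (f∈g , f∉Outside) , f∉Mixed = f-remains in (f∈g , f∉Mixed) , f∉Outside

    cocircuit-elimination : ∀ {𝒞 𝒞* : SignedSet E} → (∀ X → 𝒞* X → Circuit (dual M) (support X)) →
      NeverConformal 𝒞 𝒞* → FarkasOriented M 𝒞 𝒞* → CE 𝒞*
    cocircuit-elimination 𝒞*-cocircuits never far U U∈𝒞* X _ Ux Ux∈𝒞* Ux∩X x∈sep f f∈U f∉sep =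
      [ (λ (circuit-side , _) → ⊥-elim (no-cowitness (λ e → e) (witness-through circuit-side)))
      , (λ (_ , cocircuit-side) → eliminant (λ e → e) (witness-through cocircuit-side)) ]′
        (far Outside Mixed proj₁ Mixed⊆g Outside#Mixed (A (λ e → e)) proj₁ f f-remains)
      where
      open Elimination (λ Y Y∈𝒞* → proj₁ (proj₁ (𝒞*-cocircuits Y Y∈𝒞*))) (never-conformal-sym never)
                       U U∈𝒞* X Ux Ux∈𝒞* Ux∩X x∈sep f f∈U f∉sep

corollary5p22 : {E : Set} →
    ((P : Set₁) → Dec P) →
    (M : IndepSys E) → IsMatroid M →
    (𝒞 𝒞* : SignedSet E) →
    CircuitSignature M 𝒞 → CocircuitSignature M 𝒞* →
    FarkasOriented M 𝒞 𝒞* →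
    CE 𝒞 × CE 𝒞*
corollary5p22 dec M isM 𝒞 𝒞* (𝒞-circuits , _) (𝒞*-cocircuits , _) far =
  circuit-elimination 𝒞-circuits never far , cocircuit-elimination 𝒞*-cocircuits never far
  where
  open Classical dec
  open Matroid M isM
  never : NeverConformal 𝒞 𝒞*
  never = farkas⇒never-conformal 𝒞-circuits 𝒞*-cocircuits far
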